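{- Let $n,s\ge1$ and let $\lambda$ be the edge labeling of $\Pi_{n,s+1}$ described in the context. Then: (1) If $x\le y$ in $\Pi_{n,s+1}$ with $x\ne\hat0$, then $A(y)\le A(x)$ in the lexicographic order on atoms. (2) Any saturated chain $\hat0\lessdot C_1\lessdot\cdots\lessdot C_d$ in $\Pi_{n,s+1}$ that contains a covering $x\lessdot y$ with $A(x)\ne A(y)$ is not increasing. (3) If $x\lessdot y$ with $x\neq\hat 0$, $A(x)\ne A(y)$ and $\lambda(x\lessdot y)=(k,i,j)$, then $w^i_k(x)>w^i_k(y)=j$. (4) If $x=(P,w^1,\ldots,w^s)\lessdot y=(P',w^{1\prime},\ldots,w^{s\prime})$ with $x\neq\hat0$, $A(x)\ne A(y)$ and $\lambda(x\lessdot y)=(k,i,j)$, then $P'$ is obtained from $P$ by merging the part of $P$ containing $k$ with the part of $P$ whose $i$-th label contains $j$. (5) Let $x\le y$ with $x\ne\hat0$ and $A(x)\neq A(y)$, and let $(k,i)$ be the lexicographically least pair (compared first by $k$, then by $i$) with $w^i_k(x)\ne w^i_k(y)$, and $j=w^i_k(y)$. Then every maximal chain of the interval $[x,y]$ contains exactly one covering with label $(k,i,j)$, and every covering in $[x,y]$ has label $\ge(k,i,j)$.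
   Context: A vector partition of $[n]$ into $s+1$ components is a tuple $(P,w^1,\ldots,w^s)$ where $P$ is a set partition of $[n]$ and each $w^i$ assigns to every part $B$ of $P$ a label $w^i(B)\subseteq[n]$ (its $i$-th label) with $|w^i(B)|=|B|$, such that the $i$-th labels of all parts form a partition of $[n]$. $\Pi_{n,s+1}$ is the set of these tuples together with an added least element $\hat0$, ordered by $(P,w)\le(P',w')$ iff every part $B'$ of $P'$ is a union of parts of $P$ and, for each $i$, $w^{i\prime}(B')$ is the union of $w^i(B)$ over the parts $B\subseteq B'$ of $P$. Atoms: the elements whose partition is $\{1\},\ldots,\{n\}$; such an atom with $w^i(\{k\})=\{w^i_k\}$ is identified with the word $w^1_1\cdots w^1_n w^2_1\cdots w^2_n\cdots w^s_1\cdots w^s_n\in[n]^{ns}$, and atoms are totally ordered lexicographically by these words. For $x\ne\hat0$, $A(x)$ denotes the lexicographically least atom below $x$; explicitly, if $\{k_1<\cdots<k_p\}$ is a part of $x$ whose $i$-th label is $\{j_1<\cdots<j_p\}$, then $A(x)$ has $w^i_{k_a}=j_a$ for all $a$. Write $w^i_k(x)$ for the entry $w^i_k$ of $A(x)$. The edge labeling $\lambda$ assigns to each covering relation of $\Pi_{n,s+1}$ an element of $\mathbb Z^3$, where $\mathbb Z^3$ is ordered lexicographically: - if $x\lessdot y$, $x\ne\hat0$, $A(x)\ne A(y)$: $\lambda(x\lessdot y)=(k,i,j)$ where $(k,i)$ is the lexicographically least pair (first by $k$, then by $i$) with $w^i_k(x)\ne w^i_k(y)$, and $j=w^i_k(y)$;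 - if $x\lessdot y$, $x\ne\hat0$, $A(x)=A(y)$: $\lambda(x\lessdot y)=(n,\max(I\cup J),0)$ where $I,J$ are the two parts of the partition of $x$ merged to obtain the partition of $y$; - $\lambda(\hat0\lessdot a)=(n-1,s+m,0)$ where $a$ is the $m$-th atom in the lexicographic order. A chain $x_1\lessdot x_2\lessdot\cdots\lessdot x_m$ is increasing if the sequence $\lambda(x_1\lessdot x_2),\lambda(x_2\lessdot x_3),\ldots$ is strictly increasing. -}

module Defs where

open import Data.Nat using (ℕ; zero; suc; _+_; _*_; _∸_; _<_; _≤_; _⊔_; _≡ᵇ_; _<ᵇ_)
open import Data.Bool using (Bool; true; false; not; _∧_; if_then_else_; T)
open import Data.Fin using (Fin; toℕ)
import Data.Fin.Properties as FinP
open import Data.Fin.Subset using (Subset; _∈_; _⊆_; _∪_; ∣_∣; ⁅_⁆)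
open import Data.Fin.Subset.Properties using (_∈?_)
open import Data.Vec.Properties using (≡-dec)
import Data.Bool.Properties as BoolP
open import Data.List using (List; []; _∷_; length; map; concatMap; filterᵇ; allFin; upTo; _++_)
open import Data.Product using (Σ; ∃; _×_; _,_)
open import Data.Sum using (_⊎_)
open import Data.Unit using (⊤)
open import Data.Empty using (⊥)
open import Data.Maybe using (Maybe; just; nothing)
open import Relation.Nullary using (¬_; does)
open import Relation.Binary.PropositionalEquality using (_≡_)
open import Function.Bundles using (_⇔_)

-- Vector partitions of [n] into s+1 components (elements ≠ 0̂).
-- [n] is modelled by Fin n (element k ∈ Fin n stands for toℕ k + 1).
-- blk k    : the part of P containing k
-- lab i k  : the i-th label w^i of the part containing k

record VP (n s : ℕ) : Set where
  field
    blk      : Fin n → Subset n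
    lab      : Fin s → Fin n → Subset n
    blk-self : ∀ k → k ∈ blk k
    blk-eq   : ∀ k k′ → k′ ∈ blk k → blk k′ ≡ blk k
    lab-blk  : ∀ i k k′ → k′ ∈ blk k → lab i k′ ≡ lab i k
    lab-card : ∀ i k → ∣ lab i k ∣ ≡ ∣ blk k ∣
    lab-cov  : ∀ i j → ∃ λ k → j ∈ lab i k
    lab-disj : ∀ i k k′ j → j ∈ lab i k → j ∈ lab i k′ → k′ ∈ blk k
open VP public

module _ {n s : ℕ} where

  _≈VP_ : VP n s → VP n s → Set
  x ≈VP y = (∀ k → blk x k ≡ blk y k) × (∀ i k → lab x i k ≡ lab y i k)

  _≤VP_ : VP n s → VP n s → Set
  x ≤VP y = (∀ k k′ → k′ ∈ blk y k → blk x k′ ⊆ blk y k)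
          × (∀ i k j → (j ∈ lab y i k) ⇔ (∃ λ k′ → k′ ∈ blk y k × j ∈ lab x i k′))

-- Π_{n,s+1}: vector partitions together with an added least element 0̂.
data Π (n s : ℕ) : Set where
  0̂  : Π n s
  ⟨_⟩ : VP n s → Π n s

module _ {n s : ℕ} where

  _≈_ : Π n s → Π n s → Set
  0̂ ≈ 0̂ = ⊤
  0̂ ≈ ⟨ _ ⟩ = ⊥
  ⟨ _ ⟩ ≈ 0̂ = ⊥
  ⟨ x ⟩ ≈ ⟨ y ⟩ = x ≈VP y

  _≤_ₚ : Π n s → Π n s → Set
  0̂ ≤ _ ₚ = ⊤
  ⟨ _ ⟩ ≤ 0̂ ₚ = ⊥
  ⟨ x ⟩ ≤ ⟨ y ⟩ ₚ = x ≤VP y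

  _<_ₚ : Π n s → Π n s → Set
  x < y ₚ = (x ≤ y ₚ) × ¬ (x ≈ y)

  _⋖_ : Π n s → Π n s → Set
  x ⋖ y = (x < y ₚ) × (∀ z → x ≤ z ₚ → z ≤ y ₚ → (z ≈ x) ⊎ (z ≈ y))

-- The least atom A(x) below x ≠ 0̂, via the explicit description:
-- if k is the a-th smallest element of its part, w^i_k(x) is the
-- a-th smallest element of the i-th label of that part.

elems : ∀ {n} → Subset n → List (Fin n)
elems {n} p = filterᵇ (λ k → does (k ∈? p)) (allFin n)

-- a-th entry (0-based) of a list, with a default (never used for
-- genuine vector partitions)
nth : ∀ {A : Set} → A → List A → ℕ → A
nth d []       _       = d
nth d (x ∷ xs) zero    = x
nth d (x ∷ xs) (suc a) = nth d xs a

wA : ∀ {n s} → VP n s → Fin s → Fin n → Fin n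
wA x i k = nth k (elems (lab x i k))
               (length (filterᵇ (λ k′ → toℕ k′ <ᵇ toℕ k) (elems (blk x k))))

Aword : ∀ {n s} → VP n s → List ℕ
Aword {n} {s} x = concatMap (λ i → map (λ k → toℕ (wA x i k)) (allFin n)) (allFin s)

lexLtᵇ : List ℕ → List ℕ → Bool
lexLtᵇ []       _        = false
lexLtᵇ (_ ∷ _)  []       = false
lexLtᵇ (a ∷ as) (b ∷ bs) = if a <ᵇ b then true else ((a ≡ᵇ b) ∧ lexLtᵇ as bs)

LexLt : List ℕ → List ℕ → Set
LexLt u v = T (lexLtᵇ u v)

LexLe : List ℕ → List ℕ → Set
LexLe u v = (u ≡ v) ⊎ LexLt u v

wordsOf : ℕ → ℕ → List (List ℕ)
wordsOf n zero    = [] ∷ []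
wordsOf n (suc L) = concatMap (λ a → map (a ∷_) (wordsOf n L)) (upTo n)

elemᵇ : ℕ → List ℕ → Bool
elemᵇ a []       = false
elemᵇ a (b ∷ bs) = if a ≡ᵇ b then true else elemᵇ a bs

noDupᵇ : List ℕ → Bool
noDupᵇ []       = true
noDupᵇ (a ∷ as) = not (elemᵇ a as) ∧ noDupᵇ as

-- words of atoms of Π_{n,t+1}: concatenations of t permutations of [n]
atomWords : ℕ → ℕ → List (List ℕ)
atomWords n zero    = [] ∷ []
atomWords n (suc t) = concatMap (λ p → map (p ++_) (atomWords n t))
                                (filterᵇ noDupᵇ (wordsOf n n))

-- m such that the atom a is the m-th atom in lexicographic order (1-based)
atomIndex : ∀ {n s} → VP n s → ℕ
atomIndex {n} {s} a = suc (length (filterᵇ (λ u → lexLtᵇ u (Aword a)) (atomWords n s)))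

-- The edge labeling λ, with values in ℕ³ ⊆ ℤ³ (lexicographic order)

Label : Set
Label = ℕ × ℕ × ℕ

_<L_ : Label → Label → Set
(a , b , c) <L (a′ , b′ , c′) =
  (a < a′) ⊎ ((a ≡ a′) × ((b < b′) ⊎ ((b ≡ b′) × (c < c′))))

_≤L_ : Label → Label → Set
t ≤L t′ = (t ≡ t′) ⊎ (t <L t′)

_≡Lᵇ_ : Label → Label → Bool
(a , b , c) ≡Lᵇ (a′ , b′ , c′) = (a ≡ᵇ a′) ∧ ((b ≡ᵇ b′) ∧ (c ≡ᵇ c′))

pairsKI : (n s : ℕ) → List (Fin n × Fin s)
pairsKI n s = concatMap (λ k → map (λ i → (k , i)) (allFin s)) (allFin n)

firstDiff : ∀ {n s} → VP n s → VP n s → List (Fin n × Fin s) → Maybe Label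
firstDiff x y []             = nothing
firstDiff x y ((k , i) ∷ ps) with does (wA x i k FinP.≟ wA y i k)
... | true  = firstDiff x y ps
... | false = just (suc (toℕ k) , suc (toℕ i) , suc (toℕ (wA y i k)))

-- max(I ∪ J): the largest element whose part changes from x to y
maxMerged : ∀ {n s} → VP n s → VP n s → ℕ
maxMerged {n} x y = go (allFin n)
  where
  go : List (Fin n) → ℕ
  go []       = 0
  go (k ∷ ks) = (if does (≡-dec BoolP._≟_ (blk x k) (blk y k)) then 0 else suc (toℕ k)) ⊔ go ks

labelVP : ∀ {n s} → VP n s → VP n s → Label
labelVP {n} {s} x y with firstDiff x y (pairsKI n s)
... | just t  = t
... | nothing = (n , maxMerged x y , 0)

-- λ on coverings of Π_{n,s+1} (the value on non-coverings is irrelevant)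
λ′ : ∀ {n s} → Π n s → Π n s → Label
λ′ {n} {s} 0̂     ⟨ a ⟩ = (n ∸ 1 , s + atomIndex a , 0)
λ′         ⟨ x ⟩ ⟨ y ⟩ = labelVP x y
λ′         _     _     = (0 , 0 , 0)

module _ {n s : ℕ} where

  Saturated : List (Π n s) → Set
  Saturated []            = ⊤
  Saturated (_ ∷ [])      = ⊤
  Saturated (x ∷ y ∷ zs)  = (x ⋖ y) × Saturated (y ∷ zs)

  Increasing : List (Π n s) → Set
  Increasing (x ∷ y ∷ z ∷ zs) = (λ′ x y <L λ′ y z) × Increasing (y ∷ z ∷ zs)
  Increasing _                = ⊤

  HasAChange : List (VP n s) → Set
  HasAChange (x ∷ y ∷ zs) = ¬ (Aword x ≡ Aword y) ⊎ HasAChange (y ∷ zs)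
  HasAChange _            = ⊥

  countLabel : Label → List (Π n s) → ℕ
  countLabel t (x ∷ y ∷ zs) = (if λ′ x y ≡Lᵇ t then 1 else 0) + countLabel t (y ∷ zs)
  countLabel t _            = 0

  first last : Π n s → List (Π n s) → Π n s
  first d []       = d
  first d (x ∷ _)  = x
  last d []        = d
  last d (x ∷ xs)  = last x xs

  MaxChain : Π n s → Π n s → List (Π n s) → Set
  MaxChain x y cs = Saturated cs × (first 0̂ cs ≈ x) × (last 0̂ cs ≈ y) × ¬ (cs ≡ [])

  MergedFrom : VP n s → VP n s → Fin n → Fin n → Set
  MergedFrom x y k k′ =
    ∀ m → blk y m ≡ (if does (m ∈? (blk x k ∪ blk x k′)) then blk x k ∪ blk x k′ else blk x m)

-- Within each part of x, the row w^i of A(x) is the increasing bijection from the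
-- part onto its i-th label, so each row is a permutation of [n].  Going up from x to
-- y only merges parts and labels; hence if x and y agree in row i before position k,
-- then w^i_k(y) ≤ w^i_k(x), since a smaller letter of y's label would already be
-- used at an earlier position.  Everything follows from this monotonicity.
-- (1) compares the rows of A(x) and A(y) letter by letter.  (3) is the strict case
-- at the first difference (k, i).  (2): two permutations never first differ at their
-- last position, so a covering that changes A has a label (k, i, j) with k < n,
-- below the label (n - 1, s + m, 0) of the bottom covering 0̂ ⋖ C₁, which an
-- increasing chain would have to exceed.  (4): j comes from a part of x other than
-- that of k, and merging the two parts gives an element between x and y.  (5): every
-- element of [x, y] is squeezed to agree with x and y before (k, i); along a maximal
-- chain w^i_k then decreases weakly from w^i_k(x) to j, and the label (k, i, j)
-- occurs exactly at the step where it reaches j.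

module Submission where

open import Defs
open import Data.Nat using (ℕ; zero; suc; _+_; _<_; _≤_; _<ᵇ_; _≡ᵇ_; z≤n; s≤s; z<s)
import Data.Nat.Properties as ℕ
open import Data.Fin using (Fin; toℕ; zero; suc; punchOut) renaming (_<_ to _<ᶠ_)
import Data.Fin.Induction as Fin
import Data.Fin.Properties as Fin
open import Data.Fin.Subset using (Subset; _∈_; _⊆_; _∪_; ∣_∣; inside; outside)
open import Data.Fin.Subset.Properties using (_∈?_; x∈p∪q⁺; x∈p∪q⁻)
import Data.Vec.Base as Vec
open import Data.Bool using (Bool; true; false; T; T?; if_then_else_)
open import Data.Bool.Properties using (T-∧)
open import Data.List using (List; []; _∷_; map; length; filterᵇ; allFin; tabulate; concat; concatMap; _++_)
open import Data.List.Membership.Propositional using () renaming (_∈_ to _∈ₗ_)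
import Data.List.Membership.Propositional.Properties as ∈ₗ
import Data.List.Properties as List
open import Data.List.Relation.Unary.Any using (here; there)
import Data.List.Relation.Unary.Any as Any
open import Data.List.Relation.Unary.All using (All; []; _∷_)
import Data.List.Relation.Unary.All as All
import Data.List.Relation.Unary.All.Properties as All
open import Data.List.Relation.Unary.AllPairs using (AllPairs; []; _∷_)
import Data.List.Relation.Unary.AllPairs.Properties as AllPairs
open import Data.Product using (∃; ∃₂; _×_; _,_; proj₁; proj₂)
open import Data.Product.Properties using (,-injective)
open import Data.Product.Relation.Binary.Lex.Strict using (×-Lex; ×-strictTotalOrder)
open import Data.Product.Relation.Binary.Pointwise.NonDependent using (≡×≡⇒≡)
open import Data.Maybe using (just; nothing)
open import Data.Maybe.Properties using (just-injective)
open import Data.Sum using (_⊎_; inj₁; inj₂)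
open import Data.Empty using (⊥; ⊥-elim)
open import Function using (_∘_)
open import Function.Bundles using (Equivalence; _⇔_; mk⇔)
open import Function.Definitions using (Injective)
open import Relation.Nullary using (¬_; Dec; does; yes; no)
open import Relation.Nullary.Reflects using (Reflects; ofʸ; ofⁿ; fromEquivalence)
open import Relation.Nullary.Decidable using (dec-true; dec-false)
open import Induction.WellFounded using (Acc; acc)
open import Relation.Binary.Bundles using (StrictTotalOrder)
open import Relation.Binary.Definitions using (tri<; tri≈; tri>)
open import Relation.Binary.PropositionalEquality

-- Sorted lists and ranks

nth-∈ : ∀ {A : Set} (d : A) xs {t} → t < length xs → nth d xs t ∈ₗ xs
nth-∈ d (c ∷ cs) {zero}  _        = here refl
nth-∈ d (c ∷ cs) {suc t} (s≤s t<) = there (nth-∈ d cs t<)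

module _ {n : ℕ} where

  rank : List (Fin n) → Fin n → ℕ
  rank xs a = length (filterᵇ (λ b → toℕ b <ᵇ toℕ a) xs)

  Sorted : List (Fin n) → Set
  Sorted = AllPairs (λ a b → toℕ a < toℕ b)

  rank≡0 : ∀ xs a → All (λ b → toℕ a < toℕ b) xs → rank xs a ≡ 0
  rank≡0 [] a [] = refl
  rank≡0 (b ∷ bs) a (a<b ∷ a<bs) with toℕ b <ᵇ toℕ a | ℕ.<ᵇ-reflects-< (toℕ b) (toℕ a)
  ... | _ | ofʸ b<a = ⊥-elim (ℕ.<-asym a<b b<a)
  ... | _ | ofⁿ _   = rank≡0 bs a a<bs

  rank-mono-≤ : ∀ xs {a b} → toℕ a ≤ toℕ b → rank xs a ≤ rank xs b
  rank-mono-≤ [] a≤b = z≤n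
  rank-mono-≤ (c ∷ cs) {a} {b} a≤b
    with toℕ c <ᵇ toℕ a | ℕ.<ᵇ-reflects-< (toℕ c) (toℕ a)
       | toℕ c <ᵇ toℕ b | ℕ.<ᵇ-reflects-< (toℕ c) (toℕ b)
  ... | _ | ofʸ _   | _ | ofʸ _   = s≤s (rank-mono-≤ cs a≤b)
  ... | _ | ofʸ c<a | _ | ofⁿ c≮b = ⊥-elim (c≮b (ℕ.<-≤-trans c<a a≤b))
  ... | _ | ofⁿ _   | _ | ofʸ _   = ℕ.m≤n⇒m≤1+n (rank-mono-≤ cs a≤b)
  ... | _ | ofⁿ _   | _ | ofⁿ _   = rank-mono-≤ cs a≤b

  rank-mono-< : ∀ xs {a b} → a ∈ₗ xs → toℕ a < toℕ b → rank xs a < rank xs b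
  rank-mono-< (c ∷ cs) {a} {b} a∈ a<b
    with toℕ c <ᵇ toℕ a | ℕ.<ᵇ-reflects-< (toℕ c) (toℕ a)
       | toℕ c <ᵇ toℕ b | ℕ.<ᵇ-reflects-< (toℕ c) (toℕ b)
  rank-mono-< (c ∷ cs) (here refl) a<b | _ | ofʸ c<c | _ | _ = ⊥-elim (ℕ.<-irrefl refl c<c)
  rank-mono-< (c ∷ cs) (here refl) a<b | _ | ofⁿ _ | _ | ofʸ _ = s≤s (rank-mono-≤ cs (ℕ.<⇒≤ a<b))
  rank-mono-< (c ∷ cs) (here refl) a<b | _ | ofⁿ _ | _ | ofⁿ c≮b = ⊥-elim (c≮b a<b)
  rank-mono-< (c ∷ cs) (there a∈) a<b | _ | ofʸ c<a | _ | ofⁿ c≮b = ⊥-elim (c≮b (ℕ.<-trans c<a a<b))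
  rank-mono-< (c ∷ cs) (there a∈) a<b | _ | ofʸ _ | _ | ofʸ _ = s≤s (rank-mono-< cs a∈ a<b)
  rank-mono-< (c ∷ cs) (there a∈) a<b | _ | ofⁿ _ | _ | ofʸ _ = ℕ.m≤n⇒m≤1+n (rank-mono-< cs a∈ a<b)
  rank-mono-< (c ∷ cs) (there a∈) a<b | _ | ofⁿ _ | _ | ofⁿ _ = rank-mono-< cs a∈ a<b

  rank<length : ∀ xs {a} → a ∈ₗ xs → rank xs a < length xs
  rank<length (c ∷ cs) (here refl) with toℕ c <ᵇ toℕ c | ℕ.<ᵇ-reflects-< (toℕ c) (toℕ c)
  ... | _ | ofʸ c<c = ⊥-elim (ℕ.<-irrefl refl c<c)
  ... | _ | ofⁿ _   = s≤s (List.length-filter _ cs)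
  rank<length (c ∷ cs) {a} (there a∈) with toℕ c <ᵇ toℕ a
  ... | true  = s≤s (rank<length cs a∈)
  ... | false = ℕ.m≤n⇒m≤1+n (rank<length cs a∈)

  nth-rank : ∀ (d : Fin n) {xs} → Sorted xs → ∀ {a} → a ∈ₗ xs → nth d xs (rank xs a) ≡ a
  nth-rank d {c ∷ cs} (c<cs ∷ _) (here refl) with toℕ c <ᵇ toℕ c | ℕ.<ᵇ-reflects-< (toℕ c) (toℕ c)
  ... | _ | ofʸ c<c = ⊥-elim (ℕ.<-irrefl refl c<c)
  ... | _ | ofⁿ _ rewrite rank≡0 cs c c<cs = refl
  nth-rank d {c ∷ cs} (c<cs ∷ sorted) {a} (there a∈) with toℕ c <ᵇ toℕ a | ℕ.<ᵇ-reflects-< (toℕ c) (toℕ a)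
  ... | _ | ofʸ _   = nth-rank d sorted a∈
  ... | _ | ofⁿ c≮a = ⊥-elim (c≮a (All.lookup c<cs a∈))

  rank-nth : ∀ (d : Fin n) {xs} → Sorted xs → ∀ {t} → t < length xs → rank xs (nth d xs t) ≡ t
  rank-nth d {c ∷ cs} (c<cs ∷ _) {zero} _ with toℕ c <ᵇ toℕ c | ℕ.<ᵇ-reflects-< (toℕ c) (toℕ c)
  ... | _ | ofʸ c<c = ⊥-elim (ℕ.<-irrefl refl c<c)
  ... | _ | ofⁿ _   = rank≡0 cs c c<cs
  rank-nth d {c ∷ cs} (c<cs ∷ sorted) {suc t} (s≤s t<)
    with toℕ c <ᵇ toℕ (nth d cs t) | ℕ.<ᵇ-reflects-< (toℕ c) (toℕ (nth d cs t))
  ... | _ | ofʸ _   = cong suc (rank-nth d sorted t<)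
  ... | _ | ofⁿ c≮ = ⊥-elim (c≮ (All.lookup c<cs (nth-∈ d cs t<)))


  rank-injective : ∀ {xs} → Sorted xs → ∀ {a b} → a ∈ₗ xs → b ∈ₗ xs → rank xs a ≡ rank xs b → a ≡ b
  rank-injective {xs} sorted {a} {b} a∈ b∈ eq = begin
    a                        ≡⟨ nth-rank a sorted a∈ ⟨
    nth a xs (rank xs a)     ≡⟨ cong (nth a xs) eq ⟩
    nth a xs (rank xs b)     ≡⟨ nth-rank a sorted b∈ ⟩
    b                        ∎
    where open ≡-Reasoning

length-filterᵇ-tabulate : ∀ {m} {A B : Set} (p : A → Bool) (q : B → Bool) (f : Fin m → A) (g : Fin m → B) →
                          (∀ k → p (f k) ≡ q (g k)) →
                          length (filterᵇ p (tabulate f)) ≡ length (filterᵇ q (tabulate g))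
length-filterᵇ-tabulate {zero}  p q f g pf≡qg = refl
length-filterᵇ-tabulate {suc m} p q f g pf≡qg rewrite pf≡qg zero with q (g zero)
... | true  = cong suc (length-filterᵇ-tabulate p q (f ∘ suc) (g ∘ suc) (pf≡qg ∘ suc))
... | false = length-filterᵇ-tabulate p q (f ∘ suc) (g ∘ suc) (pf≡qg ∘ suc)

length-elems-tail : ∀ {n} b (S : Subset n) →
                    length (filterᵇ (λ k → does (k ∈? b Vec.∷ S)) (tabulate suc)) ≡ length (elems S)
length-elems-tail b S = length-filterᵇ-tabulate _ (λ k → does (k ∈? S)) suc (λ k → k) (λ _ → refl)

length-elems : ∀ {n} (S : Subset n) → length (elems S) ≡ ∣ S ∣
length-elems Vec.[]            = refl
length-elems (inside Vec.∷ S)  = cong suc (trans (length-elems-tail inside S) (length-elems S))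
length-elems (outside Vec.∷ S) = trans (length-elems-tail outside S) (length-elems S)

module _ {n : ℕ} where

  elems-sorted : (S : Subset n) → Sorted (elems S)
  elems-sorted S = AllPairs.filter⁺ _ (AllPairs.tabulate⁺-< (λ k<k′ → k<k′))

  ∈-elems⁺ : ∀ {S : Subset n} {k} → k ∈ S → k ∈ₗ elems S
  ∈-elems⁺ {S} {k} k∈S =
    ∈ₗ.∈-filter⁺ (λ k → T? (does (k ∈? S))) (∈ₗ.∈-allFin k) (subst T (sym (dec-true (k ∈? S) k∈S)) _)

  ∈-elems⁻ : ∀ {S : Subset n} {k} → k ∈ₗ elems S → k ∈ S
  ∈-elems⁻ {S} {k} k∈ with k ∈? S | proj₂ (∈ₗ.∈-filter⁻ (λ k → T? (does (k ∈? S))) {xs = allFin n} k∈)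
  ... | yes k∈S | _ = k∈S

-- The least atom A(x)

module _ {n s : ℕ} (x : VP n s) (i : Fin s) where

  private
    rank-self<length-lab : ∀ k → rank (elems (blk x k)) k < length (elems (lab x i k))
    rank-self<length-lab k =
      subst (rank (elems (blk x k)) k <_) |blk|≡|lab| (rank<length _ (∈-elems⁺ (blk-self x k)))
      where
      |blk|≡|lab| : length (elems (blk x k)) ≡ length (elems (lab x i k))
      |blk|≡|lab| = begin
        length (elems (blk x k)) ≡⟨ length-elems (blk x k) ⟩
        ∣ blk x k ∣              ≡⟨ lab-card x i k ⟨
        ∣ lab x i k ∣            ≡⟨ length-elems (lab x i k) ⟨
        length (elems (lab x i k)) ∎
        where open ≡-Reasoning

  wA∈lab : ∀ k → wA x i k ∈ lab x i k
  wA∈lab k = ∈-elems⁻ (nth-∈ k (elems (lab x i k)) (rank-self<length-lab k))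

  rank-wA : ∀ k → rank (elems (lab x i k)) (wA x i k) ≡ rank (elems (blk x k)) k
  rank-wA k = rank-nth k (elems-sorted _) (rank-self<length-lab k)

  module _ {k k′ : Fin n} (k′∈k : k′ ∈ blk x k) where

    wA∈lab-part : wA x i k′ ∈ lab x i k
    wA∈lab-part = subst (wA x i k′ ∈_) (lab-blk x i k k′ k′∈k) (wA∈lab k′)

    rank-wA-part : rank (elems (lab x i k)) (wA x i k′) ≡ rank (elems (blk x k)) k′
    rank-wA-part rewrite sym (lab-blk x i k k′ k′∈k) | sym (blk-eq x k k′ k′∈k) = rank-wA k′

  wA-injective : ∀ {k k′} → wA x i k ≡ wA x i k′ → k ≡ k′
  wA-injective {k} {k′} eq =
    rank-injective (elems-sorted (blk x k)) (∈-elems⁺ (blk-self x k)) (∈-elems⁺ k′∈k) ranks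
    where
    k′∈k : k′ ∈ blk x k
    k′∈k = lab-disj x i k k′ (wA x i k) (wA∈lab k) (subst (_∈ lab x i k′) (sym eq) (wA∈lab k′))
    ranks : rank (elems (blk x k)) k ≡ rank (elems (blk x k)) k′
    ranks = begin
      rank (elems (blk x k)) k             ≡⟨ rank-wA k ⟨
      rank (elems (lab x i k)) (wA x i k)  ≡⟨ cong (rank (elems (lab x i k))) eq ⟩
      rank (elems (lab x i k)) (wA x i k′) ≡⟨ rank-wA-part k′∈k ⟩
      rank (elems (blk x k)) k′            ∎
      where open ≡-Reasoning

  lab<wA⇒earlier : ∀ k {v} → v ∈ lab x i k → toℕ v < toℕ (wA x i k) →
                   ∃ λ k′ → k′ ∈ blk x k × toℕ k′ < toℕ k × wA x i k′ ≡ v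
  lab<wA⇒earlier k {v} v∈ v<wA = k′ , k′∈k , k′<k , wA-k′≡v
    where
    B = elems (blk x k)
    L = elems (lab x i k)
    t = rank L v
    t<rank-k : t < rank B k
    t<rank-k = subst (t <_) (rank-wA k) (rank-mono-< L (∈-elems⁺ v∈) v<wA)
    t<|B| : t < length B
    t<|B| = ℕ.<-trans t<rank-k (rank<length B (∈-elems⁺ (blk-self x k)))
    k′ = nth k B t
    k′∈k : k′ ∈ blk x k
    k′∈k = ∈-elems⁻ (nth-∈ k B t<|B|)
    rank-k′ : rank B k′ ≡ t
    rank-k′ = rank-nth k (elems-sorted _) t<|B|
    k′<k : toℕ k′ < toℕ k
    k′<k = ℕ.≰⇒> λ k≤k′ → ℕ.<⇒≱ t<rank-k (subst (rank B k ≤_) rank-k′ (rank-mono-≤ B k≤k′))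
    wA-k′≡v : wA x i k′ ≡ v
    wA-k′≡v = rank-injective (elems-sorted _) (∈-elems⁺ (wA∈lab-part k′∈k)) (∈-elems⁺ v∈)
                             (trans (rank-wA-part k′∈k) rank-k′)

module _ {n s : ℕ} (x y : VP n s) (x≤y : x ≤VP y) where

  lab-mono : ∀ {i k j} → j ∈ lab x i k → j ∈ lab y i k
  lab-mono {i} {k} {j} j∈ = Equivalence.from (proj₂ x≤y i k j) (k , blk-self y k , j∈)

  wA-antitone : ∀ i k → (∀ k′ → toℕ k′ < toℕ k → wA x i k′ ≡ wA y i k′) →
                toℕ (wA y i k) ≤ toℕ (wA x i k)
  wA-antitone i k agree = ℕ.≮⇒≥ λ wx<wy →
    let k′ , _ , k′<k , wy≡wx = lab<wA⇒earlier y i k (lab-mono (wA∈lab x i k)) wx<wy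
    in ℕ.<-irrefl (cong toℕ (wA-injective x i (trans (agree k′ k′<k) wy≡wx))) k′<k

-- ×-Lex unfolds definitionally to the lexicographic order on pairs (k, i) used in the
-- statement and to _<L_ on labels, so the stdlib strict total orders apply to both.
_<ᵖ_ : ∀ {n s} → Fin n × Fin s → Fin n × Fin s → Set
_<ᵖ_ = ×-Lex _≡_ _<ᶠ_ _<ᶠ_

module IndexOrder (n s : ℕ) =
  StrictTotalOrder (×-strictTotalOrder (Fin.<-strictTotalOrder n) (Fin.<-strictTotalOrder s))

label : ∀ {n s} → Fin n → Fin s → Fin n → Label
label k i j = suc (toℕ k) , suc (toℕ i) , suc (toℕ j)

label-injective : ∀ {n s} {k k′ : Fin n} {i i′ : Fin s} {j j′} →
                  label k i j ≡ label k′ i′ j′ → k ≡ k′ × i ≡ i′ × j ≡ j′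
label-injective eq with ,-injective eq
... | k≡k′ , eq′ with ,-injective eq′
...   | i≡i′ , j≡j′ = toℕ-suc-injective k≡k′ , toℕ-suc-injective i≡i′ , toℕ-suc-injective j≡j′
  where
  toℕ-suc-injective : ∀ {m} {a b : Fin m} → suc (toℕ a) ≡ suc (toℕ b) → a ≡ b
  toℕ-suc-injective = Fin.toℕ-injective ∘ ℕ.suc-injective

module _ {n s : ℕ} where

  pairsKI-sorted : AllPairs _<ᵖ_ (pairsKI n s)
  pairsKI-sorted = subst (AllPairs _<ᵖ_ ∘ concat) (sym (List.map-tabulate (λ k → k) row))
    (AllPairs.concat⁺ (All.tabulate⁺ λ k → AllPairs.map⁺ (AllPairs.tabulate⁺-< λ i<i′ → inj₂ (refl , i<i′)))
                      (AllPairs.tabulate⁺-< λ k<k′ →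
                        All.map⁺ (All.tabulate⁺ λ _ → All.map⁺ (All.tabulate⁺ λ _ → inj₁ k<k′))))
    where
    row : Fin n → List (Fin n × Fin s)
    row k = map (k ,_) (allFin s)

  ∈-pairsKI : ∀ p → p ∈ₗ pairsKI n s
  ∈-pairsKI (k , i) = ∈ₗ.∈-concatMap⁺ (λ k → map (k ,_) (allFin s))
    (Any.map (λ { refl → ∈ₗ.∈-map⁺ (k ,_) (∈ₗ.∈-allFin i) }) (∈ₗ.∈-allFin k))

  AgreeBefore : VP n s → VP n s → Fin n → Fin s → Set
  AgreeBefore x y k i = ∀ k′ i′ → (k′ , i′) <ᵖ (k , i) → wA x i′ k′ ≡ wA y i′ k′

  FirstDifference : VP n s → VP n s → Fin n → Fin s → Set
  FirstDifference x y k i = ¬ (wA x i k ≡ wA y i k) × AgreeBefore x y k i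

  firstDifference-unique : ∀ {x y k i k′ i′} → FirstDifference x y k i → FirstDifference x y k′ i′ →
                           (k , i) ≡ (k′ , i′)
  firstDifference-unique {k = k} {i} {k′} {i′} (differ , before) (differ′ , before′)
    with IndexOrder.compare n s (k , i) (k′ , i′)
  ... | tri< lt _ _ = ⊥-elim (differ (before′ k i lt))
  ... | tri≈ _ eq _ = ≡×≡⇒≡ eq
  ... | tri> _ _ gt = ⊥-elim (differ′ (before k′ i′ gt))

  module _ (x y : VP n s) where

    firstDiff-nothing : ∀ ps → firstDiff x y ps ≡ nothing → All (λ (k , i) → wA x i k ≡ wA y i k) ps
    firstDiff-nothing [] _ = []
    firstDiff-nothing ((k , i) ∷ ps) eq with wA x i k Fin.≟ wA y i k
    ... | yes agree = agree ∷ firstDiff-nothing ps eq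

    AgreeBeforeIn : List (Fin n × Fin s) → Fin n → Fin s → Set
    AgreeBeforeIn ps k i = ∀ k′ i′ → (k′ , i′) ∈ₗ ps → (k′ , i′) <ᵖ (k , i) → wA x i′ k′ ≡ wA y i′ k′

    firstDiff-just : ∀ ps {t} → AllPairs _<ᵖ_ ps → firstDiff x y ps ≡ just t →
                     ∃₂ λ k i → t ≡ label k i (wA y i k) × ¬ (wA x i k ≡ wA y i k) × AgreeBeforeIn ps k i
    firstDiff-just ((k , i) ∷ ps) (k,i<ps ∷ sorted) eq with wA x i k Fin.≟ wA y i k
    ... | no differ = k , i , sym (just-injective eq) , differ , earlier
      where
      earlier : AgreeBeforeIn ((k , i) ∷ ps) k i
      earlier k′ i′ (here refl) lt = ⊥-elim (IndexOrder.irrefl n s (refl , refl) lt)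
      earlier k′ i′ (there p∈) lt = ⊥-elim (IndexOrder.asym n s lt (All.lookup k,i<ps p∈))
    ... | yes agree with firstDiff-just ps sorted eq
    ...   | k′ , i′ , t≡ , differ , earlier = k′ , i′ , t≡ , differ , earlier′
      where
      earlier′ : AgreeBeforeIn ((k , i) ∷ ps) k′ i′
      earlier′ k″ i″ (here refl) _ = agree
      earlier′ k″ i″ (there p∈) lt = earlier k″ i″ p∈ lt

  data LabelView (x y : VP n s) : Label → Set where
    no-difference    : (∀ k i → wA x i k ≡ wA y i k) → LabelView x y (n , maxMerged x y , 0)
    first-difference : ∀ k i → FirstDifference x y k i → LabelView x y (label k i (wA y i k))

  labelView : ∀ x y → LabelView x y (labelVP x y)
  labelView x y with firstDiff x y (pairsKI n s) in eq
  ... | nothing = no-difference λ k i → All.lookup (firstDiff-nothing x y _ eq) (∈-pairsKI (k , i))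
  ... | just t with firstDiff-just x y _ pairsKI-sorted eq
  ...   | k , i , refl , differ , earlier = first-difference k i (differ , λ k′ i′ → earlier k′ i′ (∈-pairsKI _))

  module _ {x y : VP n s} where

    firstDifference⇒labelVP : ∀ {k i} → FirstDifference x y k i → labelVP x y ≡ label k i (wA y i k)
    firstDifference⇒labelVP fd with labelVP x y | labelView x y
    ... | _ | no-difference agree = ⊥-elim (proj₁ fd (agree _ _))
    ... | _ | first-difference k′ i′ fd′ with firstDifference-unique {x = x} {y} fd fd′
    ...   | refl = refl

    labelVP≡label⇒firstDifference : ∀ {k i j} → labelVP x y ≡ label k i j →
                                    FirstDifference x y k i × wA y i k ≡ j
    labelVP≡label⇒firstDifference eq with labelVP x y | labelView x y
    labelVP≡label⇒firstDifference () | _ | no-difference _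
    ... | _ | first-difference k′ i′ fd′ with label-injective eq
    ...   | refl , refl , refl = fd′ , refl

injective⇒surjective : ∀ {m} {f : Fin m → Fin m} → Injective _≡_ _≡_ f → ∀ v → ∃ λ a → f a ≡ v
injective⇒surjective {f = f} f-inj v with Fin.any? (λ a → f a Fin.≟ v)
... | yes hit = hit
injective⇒surjective {suc m} {f} f-inj v | no miss = ⊥-elim (ℕ.<-irrefl refl (Fin.injective⇒≤ g-inj))
  where
  v≢f : ∀ a → v ≢ f a
  v≢f a v≡fa = miss (a , sym v≡fa)
  g : Fin (suc m) → Fin m
  g a = punchOut (v≢f a)
  g-inj : Injective _≡_ _≡_ g
  g-inj {a} {b} = f-inj ∘ Fin.punchOut-injective (v≢f a) (v≢f b)

below-last : ∀ {n} {k k′ : Fin n} → ¬ (suc (toℕ k) < n) → k′ ≢ k → toℕ k′ < toℕ k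
below-last k-last k′≢k =
  ℕ.≤∧≢⇒< (ℕ.≤-pred (ℕ.<-≤-trans (Fin.toℕ<n _) (ℕ.≮⇒≥ k-last))) (k′≢k ∘ Fin.toℕ-injective)

row-firstDifference⇒notLast : ∀ {n s} {x y : VP n s} {k i} → ¬ (wA x i k ≡ wA y i k) →
                              (∀ k′ → toℕ k′ < toℕ k → wA x i k′ ≡ wA y i k′) → suc (toℕ k) < n
row-firstDifference⇒notLast {n} {x = x} {y} {k} {i} differ agree with suc (toℕ k) ℕ.<? n
... | yes k-not-last = k-not-last
... | no k-last with injective⇒surjective (wA-injective x i) (wA y i k)
...   | k′ , wx≡wy with k′ Fin.≟ k
...     | yes refl = ⊥-elim (differ wx≡wy)
...     | no k′≢k =
  ⊥-elim (k′≢k (wA-injective y i (trans (sym (agree k′ (below-last k-last k′≢k))) wx≡wy)))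

-- Lexicographic comparison of A(x) and A(y)

lexLt-head : ∀ {a b} as bs → a < b → LexLt (a ∷ as) (b ∷ bs)
lexLt-head {a} {b} as bs a<b with a <ᵇ b | ℕ.<⇒<ᵇ a<b
... | true | _ = _

lexLt-cons : ∀ a as bs → LexLt as bs → LexLt (a ∷ as) (a ∷ bs)
lexLt-cons a as bs as<bs with a <ᵇ a | a ≡ᵇ a | ℕ.≡⇒≡ᵇ a a refl
... | true  | _    | _ = _
... | false | true | _ = as<bs

lexLt-++ˡ : ∀ u v v′ → LexLt v v′ → LexLt (u ++ v) (u ++ v′)
lexLt-++ˡ []      v v′ v<v′ = v<v′
lexLt-++ˡ (a ∷ u) v v′ v<v′ = lexLt-cons a (u ++ v) (u ++ v′) (lexLt-++ˡ u v v′ v<v′)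

lexLt-++ʳ : ∀ u u′ v v′ → length u ≡ length u′ → LexLt u u′ → LexLt (u ++ v) (u′ ++ v′)
lexLt-++ʳ []      _        _ _  _         ()
lexLt-++ʳ (a ∷ u) []       _ _  ()        _
lexLt-++ʳ (a ∷ u) (b ∷ u′) v v′ |u|≡|u′| u<u′ with a <ᵇ b
... | true  = _
... | false with a ≡ᵇ b
...   | true = lexLt-++ʳ u u′ v v′ (ℕ.suc-injective |u|≡|u′|) u<u′

lexLe-++ : ∀ u u′ v v′ → length u ≡ length u′ → LexLe u u′ → LexLe v v′ → LexLe (u ++ v) (u′ ++ v′)
lexLe-++ u .u v .v _        (inj₁ refl) (inj₁ refl) = inj₁ refl
lexLe-++ u .u v v′ _        (inj₁ refl) (inj₂ v<v′) = inj₂ (lexLt-++ˡ u v v′ v<v′)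
lexLe-++ u u′ v v′ |u|≡|u′| (inj₂ u<u′) _           = inj₂ (lexLt-++ʳ u u′ v v′ |u|≡|u′| u<u′)

lexLe-concatMap : ∀ {A : Set} (f g : A → List ℕ) xs → (∀ a → length (g a) ≡ length (f a)) →
                  (∀ a → LexLe (g a) (f a)) → LexLe (concatMap g xs) (concatMap f xs)
lexLe-concatMap f g []       _        _   = inj₁ refl
lexLe-concatMap f g (a ∷ xs) same-len g≤f =
  lexLe-++ (g a) (f a) _ _ (same-len a) (g≤f a) (lexLe-concatMap f g xs same-len g≤f)

lexLe-map : ∀ {n} (f g : Fin n → ℕ) {ks} → Sorted ks →
            (∀ {k} → k ∈ₗ ks → (∀ {k′} → k′ ∈ₗ ks → toℕ k′ < toℕ k → f k′ ≡ g k′) →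
                     g k ≤ f k) →
            LexLe (map g ks) (map f ks)
lexLe-map f g {[]}     _                g≤f = inj₁ refl
lexLe-map f g {k ∷ ks} (k<ks ∷ sorted) g≤f with ℕ.m≤n⇒m<n∨m≡n (g≤f (here refl) earlier-agree)
  where
  earlier-agree : ∀ {k′} → k′ ∈ₗ k ∷ ks → toℕ k′ < toℕ k → f k′ ≡ g k′
  earlier-agree (here refl) k<k = ⊥-elim (ℕ.<-irrefl refl k<k)
  earlier-agree (there k′∈) k′<k = ⊥-elim (ℕ.<-asym k′<k (All.lookup k<ks k′∈))
... | inj₁ gk<fk = inj₂ (lexLt-head (map g ks) (map f ks) gk<fk)
... | inj₂ gk≡fk with lexLe-map f g sorted (λ k₂∈ agree → g≤f (there k₂∈) (agree′ agree))
  where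
  agree′ : ∀ {k₂} → (∀ {k′} → k′ ∈ₗ ks → toℕ k′ < toℕ k₂ → f k′ ≡ g k′) →
           ∀ {k′} → k′ ∈ₗ k ∷ ks → toℕ k′ < toℕ k₂ → f k′ ≡ g k′
  agree′ agree (here refl) _  = sym gk≡fk
  agree′ agree (there k′∈) lt = agree k′∈ lt
...   | inj₁ eq = inj₁ (cong₂ _∷_ gk≡fk eq)
...   | inj₂ lt rewrite gk≡fk = inj₂ (lexLt-cons (f k) (map g ks) (map f ks) lt)

allFin-sorted : ∀ n → Sorted (allFin n)
allFin-sorted n = AllPairs.tabulate⁺-< (λ k<k′ → k<k′)

A-antitone : ∀ {n s} {x y : VP n s} → x ≤VP y → LexLe (Aword y) (Aword x)
A-antitone {n} {s} {x} {y} x≤y = lexLe-concatMap _ _ (allFin s) same-length row-antitone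
  where
  row : VP n s → Fin s → List ℕ
  row z i = map (toℕ ∘ wA z i) (allFin n)
  same-length : ∀ i → length (row y i) ≡ length (row x i)
  same-length i = trans (List.length-map _ (allFin n)) (sym (List.length-map _ (allFin n)))
  row-antitone : ∀ i → LexLe (row y i) (row x i)
  row-antitone i = lexLe-map _ _ (allFin-sorted n) λ {k} _ agree →
    wA-antitone x y x≤y i k λ k′ k′<k → Fin.toℕ-injective (agree (∈ₗ.∈-allFin k′) k′<k)

-- Coverings that change A

module LabelOrder = StrictTotalOrder
  (×-strictTotalOrder ℕ.<-strictTotalOrder (×-strictTotalOrder ℕ.<-strictTotalOrder ℕ.<-strictTotalOrder))

≤L-<L-trans : ∀ {t t′ t″} → t ≤L t′ → t′ <L t″ → t <L t″
≤L-<L-trans (inj₁ refl) t′<t″ = t′<t″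
≤L-<L-trans (inj₂ t<t′) t′<t″ = LabelOrder.trans t<t′ t′<t″

≡Lᵇ-reflects : ∀ t t′ → Reflects (t ≡ t′) (t ≡Lᵇ t′)
≡Lᵇ-reflects t@(a , b , c) t′@(a′ , b′ , c′) = fromEquivalence to from
  where
  to : T (t ≡Lᵇ t′) → t ≡ t′
  to t≡t′ with Equivalence.to T-∧ t≡t′
  ... | a≡a′ , bc≡b′c′ with Equivalence.to T-∧ bc≡b′c′
  ...   | b≡b′ , c≡c′ =
    ≡×≡⇒≡ (ℕ.≡ᵇ⇒≡ a a′ a≡a′ , ≡×≡⇒≡ (ℕ.≡ᵇ⇒≡ b b′ b≡b′ , ℕ.≡ᵇ⇒≡ c c′ c≡c′))
  from : t ≡ t′ → T (t ≡Lᵇ t′)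
  from refl =
    Equivalence.from T-∧ (ℕ.≡⇒≡ᵇ a a refl , Equivalence.from T-∧ (ℕ.≡⇒≡ᵇ b b refl , ℕ.≡⇒≡ᵇ c c refl))

label-mono-last : ∀ {n s} {k : Fin n} {i : Fin s} {j j′} → toℕ j ≤ toℕ j′ → label k i j ≤L label k i j′
label-mono-last j≤j′ with ℕ.m≤n⇒m<n∨m≡n j≤j′
... | inj₁ j<j′ = inj₂ (inj₂ (refl , inj₂ (refl , s≤s j<j′)))
... | inj₂ j≡j′ = inj₁ (cong (label _ _) (Fin.toℕ-injective j≡j′))

Aword-cong : ∀ {n s} {x y : VP n s} → (∀ k i → wA x i k ≡ wA y i k) → Aword x ≡ Aword y
Aword-cong {n} {s} agree =
  List.concatMap-cong (λ i → List.map-cong (λ k → cong toℕ (agree k i)) (allFin n)) (allFin s)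

module _ {n s : ℕ} where

  A-change⇒label : ∀ {x y : VP n s} → ¬ (Aword x ≡ Aword y) →
                   ∃₂ λ k i → ∃ λ j → labelVP x y ≡ label k i j × suc (toℕ k) < n
  A-change⇒label {x} {y} A≢ with labelVP x y | labelView x y
  ... | _ | no-difference agree = ⊥-elim (A≢ (Aword-cong {x = x} {y} agree))
  ... | _ | first-difference k i (differ , before) =
    k , i , wA y i k , refl , row-firstDifference⇒notLast {x = x} {y} differ (λ k′ k′<k → before k′ i (inj₁ k′<k))

  AboveAChanges : Label → Set
  AboveAChanges t = ∀ (k : Fin n) (i : Fin s) (j : Fin n) → suc (toℕ k) < n → ¬ (t <L label k i j)

  atom-label-aboveAChanges : ∀ (a : VP n s) → AboveAChanges (λ′ 0̂ ⟨ a ⟩)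
  atom-label-aboveAChanges a k i j k<n (inj₁ n-1<k) = ℕ.<-irrefl refl (ℕ.<-≤-trans n-1<k (ℕ.<⇒≤pred k<n))
  atom-label-aboveAChanges a k i j k<n (inj₂ (_ , second)) =
    ℕ.<⇒≱ (ℕ.m<m+n s z<s) (ℕ.≤-trans (≤-second second) (Fin.toℕ<n i))
    where
    ≤-second : ∀ {b c} {d : Set} → (b < c) ⊎ (b ≡ c × d) → b ≤ c
    ≤-second (inj₁ b<c)       = ℕ.<⇒≤ b<c
    ≤-second (inj₂ (refl , _)) = ℕ.≤-refl

  increasing-above⇒¬HasAChange : ∀ {t} → AboveAChanges t → ∀ p c cs → t ≤L λ′ p ⟨ c ⟩ →
                                 Increasing (p ∷ ⟨ c ⟩ ∷ map ⟨_⟩ cs) → ¬ HasAChange (c ∷ cs)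
  increasing-above⇒¬HasAChange above p c (d ∷ cs) t≤ (increasing , _) (inj₁ A≢)
    with A-change⇒label {x = c} {d} A≢
  ... | k , i , j , labelVP≡ , k<n = above k i j k<n (subst (_ <L_) labelVP≡ (≤L-<L-trans t≤ increasing))
  increasing-above⇒¬HasAChange above p c (d ∷ cs) t≤ (increasing , increasing′) (inj₂ change) =
    increasing-above⇒¬HasAChange above ⟨ c ⟩ d cs (inj₂ (≤L-<L-trans t≤ increasing)) increasing′ change

  firstDifference⇒wA< : ∀ {x y : VP n s} {k i} → x ≤VP y → FirstDifference x y k i →
                        toℕ (wA y i k) < toℕ (wA x i k)
  firstDifference⇒wA< {x} {y} {k} {i} x≤y (differ , before) =
    ℕ.≤∧≢⇒< (wA-antitone x y x≤y i k λ k′ k′<k → before k′ i (inj₁ k′<k))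
            (differ ∘ Fin.toℕ-injective ∘ sym)

  label-entry-decreases : ∀ {x y : VP n s} {k i j} → x ≤VP y → labelVP x y ≡ label k i j →
                          wA y i k ≡ j × toℕ (wA y i k) < toℕ (wA x i k)
  label-entry-decreases {x} {y} x≤y labelVP≡ =
    let fd , wy≡j = labelVP≡label⇒firstDifference {x = x} {y} labelVP≡
    in wy≡j , firstDifference⇒wA< {x = x} {y} x≤y fd

  bottom-chain-not-increasing : ∀ cs → HasAChange cs → ¬ Increasing (0̂ ∷ map ⟨_⟩ cs)
  bottom-chain-not-increasing (c ∷ cs) change increasing =
    increasing-above⇒¬HasAChange (atom-label-aboveAChanges c) 0̂ c cs (inj₁ refl) increasing change

-- The order on vector partitions

module _ {n s : ℕ} where

  ≈VP⇒≤VP : ∀ {x y : VP n s} → x ≈VP y → x ≤VP y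
  ≈VP⇒≤VP {x} {y} (same-blk , same-lab) = parts , labels
    where
    parts : ∀ k k′ → k′ ∈ blk y k → blk x k′ ⊆ blk y k
    parts k k′ k′∈ = subst (_ ∈_) (trans (same-blk k′) (blk-eq y k k′ k′∈))
    labels : ∀ i k j → (j ∈ lab y i k) ⇔ (∃ λ k′ → k′ ∈ blk y k × j ∈ lab x i k′)
    labels i k j = mk⇔ (λ j∈ → k , blk-self y k , subst (j ∈_) (sym (same-lab i k)) j∈)
                       λ (k′ , k′∈ , j∈) → subst (j ∈_) (trans (same-lab i k′) (lab-blk y i k k′ k′∈)) j∈

  ≤VP-refl : ∀ {x : VP n s} → x ≤VP x
  ≤VP-refl {x} = ≈VP⇒≤VP {x} {x} ((λ _ → refl) , (λ _ _ → refl))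

  ≤VP-trans : ∀ {x y z : VP n s} → x ≤VP y → y ≤VP z → x ≤VP z
  ≤VP-trans {x} {y} {z} x≤y y≤z = parts , labels
    where
    parts : ∀ k k′ → k′ ∈ blk z k → blk x k′ ⊆ blk z k
    parts k k′ k′∈ a∈ = proj₁ y≤z k k′ k′∈ (proj₁ x≤y k′ k′ (blk-self y k′) a∈)
    labels : ∀ i k j → (j ∈ lab z i k) ⇔ (∃ λ k′ → k′ ∈ blk z k × j ∈ lab x i k′)
    labels i k j =
      mk⇔ to λ (k′ , k′∈ , j∈) → Equivalence.from (proj₂ y≤z i k j) (k′ , k′∈ , lab-mono x y x≤y j∈)
      where
      to : j ∈ lab z i k → ∃ λ k′ → k′ ∈ blk z k × j ∈ lab x i k′
      to j∈z with Equivalence.to (proj₂ y≤z i k j) j∈z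
      ... | k₁ , k₁∈ , j∈y with Equivalence.to (proj₂ x≤y i k₁ j) j∈y
      ...   | k₂ , k₂∈ , j∈x = k₂ , proj₁ y≤z k k₁ k₁∈ k₂∈ , j∈x

  ≈VP-sym : ∀ {x y : VP n s} → x ≈VP y → y ≈VP x
  ≈VP-sym (same-blk , same-lab) = (λ k → sym (same-blk k)) , (λ i k → sym (same-lab i k))

  wA-cong : ∀ {x y : VP n s} → x ≈VP y → ∀ i k → wA x i k ≡ wA y i k
  wA-cong {x} {y} (same-blk , same-lab) i k =
    cong₂ (λ L B → nth k (elems L) (rank (elems B) k)) (same-lab i k) (same-blk k)

  ≤ₚ-trans : ∀ {a b c : Π n s} → a ≤ b ₚ → b ≤ c ₚ → a ≤ c ₚ
  ≤ₚ-trans {0̂}                   _   _   = _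
  ≤ₚ-trans {⟨ a ⟩} {⟨ b ⟩} {⟨ c ⟩} a≤b b≤c = ≤VP-trans {a} {b} {c} a≤b b≤c

  ≈⇒≤ₚ : ∀ {a b : Π n s} → a ≈ b → a ≤ b ₚ
  ≈⇒≤ₚ {0̂}     {0̂}     _   = _
  ≈⇒≤ₚ {⟨ a ⟩} {⟨ b ⟩} a≈b = ≈VP⇒≤VP {a} {b} a≈b

  saturated⇒≤ : ∀ a zs {b} → Saturated (a ∷ zs) → last a zs ≈ b → a ≤ b ₚ
  saturated⇒≤ a []       _                 a≈b    = ≈⇒≤ₚ {a} a≈b
  saturated⇒≤ a (c ∷ zs) ((a<c , _) , sat) last≈b =
    ≤ₚ-trans {a} {c} (proj₁ a<c) (saturated⇒≤ c zs sat last≈b)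

-- The interval [x, y] at a first difference (k, i)

module FirstDifferenceInterval {n s : ℕ} (x y : VP n s) (x≤y : x ≤VP y) (k : Fin n) (i : Fin s)
                               (differ : ¬ (wA x i k ≡ wA y i k)) (before : AgreeBefore x y k i) where

  Between : VP n s → Set
  Between z = x ≤VP z × z ≤VP y

  y-between : Between y
  y-between = x≤y , ≤VP-refl {x = y}

  private
    earlier-row : ∀ {k′ k″ i′ i″} → toℕ k″ < toℕ k′ → (k′ , i′) <ᵖ (k , i) → (k″ , i″) <ᵖ (k , i)
    earlier-row k″<k′ (inj₁ k′<k)        = inj₁ (ℕ.<-trans k″<k′ k′<k)
    earlier-row k″<k′ (inj₂ (refl , _)) = inj₁ k″<k′

  agreeBefore-between : ∀ z → Between z → AgreeBefore x z k i
  agreeBefore-between z (x≤z , z≤y) k′ i′ = go (Fin.<-wellFounded k′)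
    where
    go : ∀ {k′} → Acc _<ᶠ_ k′ → (k′ , i′) <ᵖ (k , i) → wA x i′ k′ ≡ wA z i′ k′
    go {k′} (acc smaller) k′i′<ki = Fin.toℕ-injective (ℕ.≤-antisym wx≤wz wz≤wx)
      where
      earlier : ∀ k″ → toℕ k″ < toℕ k′ → wA x i′ k″ ≡ wA z i′ k″
      earlier k″ k″<k′ = go (smaller k″<k′) (earlier-row k″<k′ k′i′<ki)
      wz≤wx : toℕ (wA z i′ k′) ≤ toℕ (wA x i′ k′)
      wz≤wx = wA-antitone x z x≤z i′ k′ earlier
      wx≤wz : toℕ (wA x i′ k′) ≤ toℕ (wA z i′ k′)
      wx≤wz = subst (λ w → toℕ w ≤ toℕ (wA z i′ k′)) (sym (before k′ i′ k′i′<ki))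
              (wA-antitone z y z≤y i′ k′ λ k″ k″<k′ →
                trans (sym (earlier k″ k″<k′)) (before k″ i′ (earlier-row k″<k′ k′i′<ki)))

  agreeBefore-within : ∀ u v → Between u → Between v → AgreeBefore u v k i
  agreeBefore-within u v u∈ v∈ k′ i′ lt =
    trans (sym (agreeBefore-between u u∈ k′ i′ lt)) (agreeBefore-between v v∈ k′ i′ lt)

  row-agree-within : ∀ u v → Between u → Between v → ∀ k′ → toℕ k′ < toℕ k → wA u i k′ ≡ wA v i k′
  row-agree-within u v u∈ v∈ k′ k′<k = agreeBefore-within u v u∈ v∈ k′ i (inj₁ k′<k)

  λ₀ : Label
  λ₀ = label k i (wA y i k)

  Reached : VP n s → Set
  Reached c = wA c i k ≡ wA y i k

  reached-mono : ∀ c d → Between c → Between d → c ≤VP d → Reached c → Reached d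
  reached-mono c d c∈ d∈ c≤d reached-c = Fin.toℕ-injective (ℕ.≤-antisym wd≤wy wy≤wd)
    where
    wd≤wy : toℕ (wA d i k) ≤ toℕ (wA y i k)
    wd≤wy = subst (λ w → toℕ (wA d i k) ≤ toℕ w) reached-c
              (wA-antitone c d c≤d i k (row-agree-within c d c∈ d∈))
    wy≤wd : toℕ (wA y i k) ≤ toℕ (wA d i k)
    wy≤wd = wA-antitone d y (proj₂ d∈) i k (row-agree-within d y d∈ y-between)

  labelVP≡λ₀⇒switch : ∀ c d → labelVP c d ≡ λ₀ → ¬ Reached c × Reached d
  labelVP≡λ₀⇒switch c d eq with labelVP≡label⇒firstDifference {x = c} {d} eq
  ... | (c≢d , _) , reached-d = (λ reached-c → c≢d (trans reached-c (sym reached-d))) , reached-d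

  switch⇒labelVP≡λ₀ : ∀ c d → Between c → Between d → ¬ Reached c → Reached d → labelVP c d ≡ λ₀
  switch⇒labelVP≡λ₀ c d c∈ d∈ ¬reached-c reached-d =
    trans (firstDifference⇒labelVP {x = c} {d} (c≢d , agreeBefore-within c d c∈ d∈)) (cong (label k i) reached-d)
    where
    c≢d : ¬ (wA c i k ≡ wA d i k)
    c≢d eq = ¬reached-c (trans eq reached-d)

  λ₀≤label-firstDifference : ∀ u v k₀ i₀ → Between u → Between v → FirstDifference u v k₀ i₀ →
                             λ₀ ≤L label k₀ i₀ (wA v i₀ k₀)
  λ₀≤label-firstDifference u v k₀ i₀ u∈ v∈ (differ₀ , _) with IndexOrder.compare n s (k₀ , i₀) (k , i)
  ... | tri< earlier _ _             = ⊥-elim (differ₀ (agreeBefore-within u v u∈ v∈ k₀ i₀ earlier))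
  ... | tri> _ _ (inj₁ k<k₀)         = inj₂ (inj₁ (s≤s k<k₀))
  ... | tri> _ _ (inj₂ (refl , i<i₀)) = inj₂ (inj₂ (refl , inj₁ (s≤s i<i₀)))
  ... | tri≈ _ (refl , refl) _       =
    label-mono-last (wA-antitone v y (proj₂ v∈) i k (row-agree-within v y v∈ y-between))

  λ₀≤labelVP : ∀ u v → Between u → Between v → λ₀ ≤L labelVP u v
  λ₀≤labelVP u v u∈ v∈ with labelVP u v | labelView u v
  ... | _ | no-difference _ =
    inj₂ (inj₁ (row-firstDifference⇒notLast {x = x} {y} differ (λ k′ k′<k → before k′ i (inj₁ k′<k))))
  ... | _ | first-difference k₀ i₀ fd = λ₀≤label-firstDifference u v k₀ i₀ u∈ v∈ fd

  next-between : ∀ c d zs → Between c → ⟨ c ⟩ ⋖ ⟨ d ⟩ → Saturated (⟨ d ⟩ ∷ zs) → last ⟨ d ⟩ zs ≈ ⟨ y ⟩ →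
                 Between d
  next-between c d zs (x≤c , _) ((c≤d , _) , _) sat last≈y =
    ≤VP-trans {x = x} {y = c} {z = d} x≤c c≤d , saturated⇒≤ ⟨ d ⟩ zs sat last≈y

  reached? : ∀ c → Dec (Reached c)
  reached? c = wA c i k Fin.≟ wA y i k

  countLabel-step : ∀ c d rest → Between c → Between d → c ≤VP d →
                    countLabel λ₀ (⟨ d ⟩ ∷ rest) ≡ (if does (reached? d) then 0 else 1) →
                    countLabel λ₀ (⟨ c ⟩ ∷ ⟨ d ⟩ ∷ rest) ≡ (if does (reached? c) then 0 else 1)
  countLabel-step c d rest c∈ d∈ c≤d count-d rewrite count-d
    with labelVP c d ≡Lᵇ λ₀ | ≡Lᵇ-reflects (labelVP c d) λ₀ | reached? c | reached? d
  ... | _ | ofʸ hit  | yes reached-c | _             = ⊥-elim (proj₁ (labelVP≡λ₀⇒switch c d hit) reached-c)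
  ... | _ | ofʸ hit  | no _          | no ¬reached-d = ⊥-elim (¬reached-d (proj₂ (labelVP≡λ₀⇒switch c d hit)))
  ... | _ | ofʸ _    | no _          | yes _         = refl
  ... | _ | ofⁿ _    | yes _         | yes _         = refl
  ... | _ | ofⁿ _    | yes reached-c | no ¬reached-d = ⊥-elim (¬reached-d (reached-mono c d c∈ d∈ c≤d reached-c))
  ... | _ | ofⁿ miss | no ¬reached-c | yes reached-d =
    ⊥-elim (miss (switch⇒labelVP≡λ₀ c d c∈ d∈ ¬reached-c reached-d))
  ... | _ | ofⁿ _    | no _          | no _          = refl

  countLabel-from : ∀ c zs → Between c → Saturated (⟨ c ⟩ ∷ zs) → last ⟨ c ⟩ zs ≈ ⟨ y ⟩ →
                    countLabel λ₀ (⟨ c ⟩ ∷ zs) ≡ (if does (reached? c) then 0 else 1)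
  countLabel-from c [] _ _ c≈y =
    sym (cong (if_then 0 else 1) (dec-true (reached? c) (wA-cong {x = c} {y} c≈y i k)))
  countLabel-from c (0̂ ∷ zs) _ (((() , _) , _) , _) _
  countLabel-from c (⟨ d ⟩ ∷ zs) c∈ (c⋖d , sat) last≈y =
    countLabel-step c d zs c∈ d∈ (proj₁ (proj₁ c⋖d)) (countLabel-from d zs d∈ sat last≈y)
    where
    d∈ : Between d
    d∈ = next-between c d zs c∈ c⋖d sat last≈y

  maxChain⇒countLabel≡1 : ∀ cs → MaxChain ⟨ x ⟩ ⟨ y ⟩ cs → countLabel λ₀ cs ≡ 1
  maxChain⇒countLabel≡1 []           (_ , _ , _ , nonempty)  = ⊥-elim (nonempty refl)
  maxChain⇒countLabel≡1 (⟨ c ⟩ ∷ zs) (sat , c≈x , last≈y , _) =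
    trans (countLabel-from c zs c∈ sat last≈y) (cong (if_then 0 else 1) (dec-false (reached? c) ¬reached-c))
    where
    x≤c : x ≤VP c
    x≤c = ≈VP⇒≤VP {x = x} {c} (≈VP-sym {x = c} {x} c≈x)
    c∈ : Between c
    c∈ = x≤c , saturated⇒≤ ⟨ c ⟩ zs sat last≈y
    ¬reached-c : ¬ Reached c
    ¬reached-c reached-c = differ (trans (sym (wA-cong {x = c} {x} c≈x i k)) reached-c)

  λ₀≤λ′ : ∀ u v → ⟨ x ⟩ ≤ u ₚ → v ≤ ⟨ y ⟩ ₚ → u ⋖ v → λ₀ ≤L λ′ u v
  λ₀≤λ′ ⟨ u ⟩ 0̂     _   _   ((() , _) , _)
  λ₀≤λ′ ⟨ u ⟩ ⟨ v ⟩ x≤u v≤y ((u≤v , _) , _) =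
    λ₀≤labelVP u v (x≤u , ≤VP-trans {x = u} {y = v} {z = y} u≤v v≤y)
                   (≤VP-trans {x = x} {y = u} {z = v} x≤u u≤v , v≤y)

-- Merging two parts

∣∪∣-disjoint : ∀ {m} (p q : Subset m) → (∀ {a} → a ∈ p → a ∈ q → ⊥) → ∣ p ∪ q ∣ ≡ ∣ p ∣ + ∣ q ∣
∣∪∣-disjoint Vec.[] Vec.[] _ = refl
∣∪∣-disjoint (a Vec.∷ p) (b Vec.∷ q) disjoint
  with ∣∪∣-disjoint p q (λ a∈p a∈q → disjoint (Vec.there a∈p) (Vec.there a∈q))
∣∪∣-disjoint (outside Vec.∷ p) (outside Vec.∷ q) _        | ih = ih
∣∪∣-disjoint (outside Vec.∷ p) (inside Vec.∷ q)  _        | ih = trans (cong suc ih) (sym (ℕ.+-suc ∣ p ∣ ∣ q ∣))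
∣∪∣-disjoint (inside Vec.∷ p)  (outside Vec.∷ q) _        | ih = cong suc ih
∣∪∣-disjoint (inside Vec.∷ p)  (inside Vec.∷ q)  disjoint | _  = ⊥-elim (disjoint Vec.here Vec.here)

module _ {n s : ℕ} (x : VP n s) where

  blk-sym : ∀ {a b} → a ∈ blk x b → b ∈ blk x a
  blk-sym {a} {b} a∈b = subst (b ∈_) (sym (blk-eq x b a a∈b)) (blk-self x b)

  blk-trans : ∀ {a b c} → a ∈ blk x b → b ∈ blk x c → a ∈ blk x c
  blk-trans {a} {b} {c} a∈b b∈c = subst (a ∈_) (blk-eq x c b b∈c) a∈b

module Merge {n s : ℕ} (x : VP n s) (k k′ : Fin n) (k′∉k : ¬ (k′ ∈ blk x k)) where

  U : Subset n
  U = blk x k ∪ blk x k′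

  LU : Fin s → Subset n
  LU i = lab x i k ∪ lab x i k′

  k∈U : k ∈ U
  k∈U = x∈p∪q⁺ (inj₁ (blk-self x k))

  k′∈U : k′ ∈ U
  k′∈U = x∈p∪q⁺ (inj₂ (blk-self x k′))

  part⊆U : ∀ {m a} → m ∈ U → a ∈ blk x m → a ∈ U
  part⊆U m∈U a∈m with x∈p∪q⁻ (blk x k) (blk x k′) m∈U
  ... | inj₁ m∈k  = x∈p∪q⁺ (inj₁ (blk-trans x a∈m m∈k))
  ... | inj₂ m∈k′ = x∈p∪q⁺ (inj₂ (blk-trans x a∈m m∈k′))

  part-meets-U : ∀ {m a} → a ∈ blk x m → a ∈ U → m ∈ U
  part-meets-U a∈m a∈U = part⊆U a∈U (blk-sym x a∈m)

  lab⊆LU : ∀ i {m j} → m ∈ U → j ∈ lab x i m → j ∈ LU i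
  lab⊆LU i {m} {j} m∈U j∈m with x∈p∪q⁻ (blk x k) (blk x k′) m∈U
  ... | inj₁ m∈k  = x∈p∪q⁺ (inj₁ (subst (j ∈_) (lab-blk x i k m m∈k) j∈m))
  ... | inj₂ m∈k′ = x∈p∪q⁺ (inj₂ (subst (j ∈_) (lab-blk x i k′ m m∈k′) j∈m))

  lab-meets-LU : ∀ i {m j} → j ∈ LU i → j ∈ lab x i m → m ∈ U
  lab-meets-LU i {m} {j} j∈LU j∈m with x∈p∪q⁻ (lab x i k) (lab x i k′) j∈LU
  ... | inj₁ j∈k  = x∈p∪q⁺ (inj₁ (lab-disj x i k m j j∈k j∈m))
  ... | inj₂ j∈k′ = x∈p∪q⁺ (inj₂ (lab-disj x i k′ m j j∈k′ j∈m))

  merged-blk : Fin n → Subset n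
  merged-blk m = if does (m ∈? U) then U else blk x m

  merged-lab : Fin s → Fin n → Subset n
  merged-lab i m = if does (m ∈? U) then LU i else lab x i m

  merged-blk-U : ∀ {m} → m ∈ U → merged-blk m ≡ U
  merged-blk-U {m} m∈U with m ∈? U
  ... | yes _   = refl
  ... | no m∉U = ⊥-elim (m∉U m∈U)

  lab⊆merged-lab : ∀ i m {j} → j ∈ lab x i m → j ∈ merged-lab i m
  lab⊆merged-lab i m j∈m with m ∈? U
  ... | yes m∈U = lab⊆LU i m∈U j∈m
  ... | no _    = j∈m

  merged : VP n s
  merged = record
    { blk = merged-blk ; lab = merged-lab
    ; blk-self = self ; blk-eq = same-blk ; lab-blk = same-lab
    ; lab-card = card ; lab-cov = cov ; lab-disj = disj }
    where
    self : ∀ m → m ∈ merged-blk m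
    self m with m ∈? U
    ... | yes m∈U = m∈U
    ... | no _    = blk-self x m
    same-blk : ∀ m m₁ → m₁ ∈ merged-blk m → merged-blk m₁ ≡ merged-blk m
    same-blk m m₁ m₁∈ with m ∈? U | m₁ ∈? U
    ... | yes _   | yes _    = refl
    ... | yes _   | no m₁∉U = ⊥-elim (m₁∉U m₁∈)
    ... | no m∉U  | yes m₁∈U = ⊥-elim (m∉U (part-meets-U m₁∈ m₁∈U))
    ... | no _    | no _     = blk-eq x m m₁ m₁∈
    same-lab : ∀ i m m₁ → m₁ ∈ merged-blk m → merged-lab i m₁ ≡ merged-lab i m
    same-lab i m m₁ m₁∈ with m ∈? U | m₁ ∈? U
    ... | yes _   | yes _    = refl
    ... | yes _   | no m₁∉U = ⊥-elim (m₁∉U m₁∈)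
    ... | no m∉U  | yes m₁∈U = ⊥-elim (m∉U (part-meets-U m₁∈ m₁∈U))
    ... | no _    | no _     = lab-blk x i m m₁ m₁∈
    card : ∀ i m → ∣ merged-lab i m ∣ ≡ ∣ merged-blk m ∣
    card i m with m ∈? U
    ... | no _  = lab-card x i m
    ... | yes _ = begin
      ∣ LU i ∣                       ≡⟨ ∣∪∣-disjoint _ _ (λ j∈k j∈k′ → k′∉k (lab-disj x i k k′ _ j∈k j∈k′)) ⟩
      ∣ lab x i k ∣ + ∣ lab x i k′ ∣ ≡⟨ cong₂ _+_ (lab-card x i k) (lab-card x i k′) ⟩
      ∣ blk x k ∣ + ∣ blk x k′ ∣     ≡⟨ ∣∪∣-disjoint _ _ (λ a∈k a∈k′ → k′∉k (blk-trans x (blk-sym x a∈k′) a∈k)) ⟨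
      ∣ U ∣                          ∎
      where open ≡-Reasoning
    cov : ∀ i j → ∃ λ m → j ∈ merged-lab i m
    cov i j with lab-cov x i j
    ... | m , j∈m = m , lab⊆merged-lab i m j∈m
    disj : ∀ i m m₁ j → j ∈ merged-lab i m → j ∈ merged-lab i m₁ → m₁ ∈ merged-blk m
    disj i m m₁ j j∈m j∈m₁ with m ∈? U | m₁ ∈? U
    ... | yes _   | yes m₁∈U = m₁∈U
    ... | yes _   | no m₁∉U  = ⊥-elim (m₁∉U (lab-meets-LU i j∈m j∈m₁))
    ... | no m∉U  | yes _    = ⊥-elim (m∉U (lab-meets-LU i j∈m₁ j∈m))
    ... | no _    | no _     = lab-disj x i m m₁ j j∈m j∈m₁

  x≤merged : x ≤VP merged
  x≤merged = parts , labels
    where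
    parts : ∀ m m₁ → m₁ ∈ merged-blk m → blk x m₁ ⊆ merged-blk m
    parts m m₁ m₁∈ a∈ with m ∈? U
    ... | yes _ = part⊆U m₁∈ a∈
    ... | no _  = blk-trans x a∈ m₁∈
    labels : ∀ i m j → (j ∈ merged-lab i m) ⇔ (∃ λ m₁ → m₁ ∈ merged-blk m × j ∈ lab x i m₁)
    labels i m j with m ∈? U
    ... | yes _ = mk⇔ to (λ (m₁ , m₁∈U , j∈) → lab⊆LU i m₁∈U j∈)
      where
      to : j ∈ LU i → ∃ λ m₁ → m₁ ∈ U × j ∈ lab x i m₁
      to j∈LU with x∈p∪q⁻ (lab x i k) (lab x i k′) j∈LU
      ... | inj₁ j∈k  = k , k∈U , j∈k
      ... | inj₂ j∈k′ = k′ , k′∈U , j∈k′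
    ... | no _ = mk⇔ (λ j∈ → m , blk-self x m , j∈)
                     (λ (m₁ , m₁∈ , j∈) → subst (j ∈_) (lab-blk x i m m₁ m₁∈) j∈)

  merged≤ : ∀ y → x ≤VP y → k′ ∈ blk y k → merged ≤VP y
  merged≤ y x≤y k′∈y = parts , labels
    where
    U⊆y : ∀ {a} → a ∈ U → a ∈ blk y k
    U⊆y a∈U with x∈p∪q⁻ (blk x k) (blk x k′) a∈U
    ... | inj₁ a∈k  = proj₁ x≤y k k (blk-self y k) a∈k
    ... | inj₂ a∈k′ = proj₁ x≤y k k′ k′∈y a∈k′
    U-part : ∀ {m m₁} → m₁ ∈ U → m₁ ∈ blk y m → blk y k ≡ blk y m
    U-part {m} {m₁} m₁∈U m₁∈m = trans (sym (blk-eq y k m₁ (U⊆y m₁∈U))) (blk-eq y m m₁ m₁∈m)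
    parts : ∀ m m₁ → m₁ ∈ blk y m → merged-blk m₁ ⊆ blk y m
    parts m m₁ m₁∈m {a} a∈ with m₁ ∈? U
    ... | yes m₁∈U = subst (a ∈_) (U-part m₁∈U m₁∈m) (U⊆y a∈)
    ... | no _     = proj₁ x≤y m m₁ m₁∈m a∈
    labels : ∀ i m j → (j ∈ lab y i m) ⇔ (∃ λ m₁ → m₁ ∈ blk y m × j ∈ merged-lab i m₁)
    labels i m j = mk⇔ to from
      where
      to : j ∈ lab y i m → ∃ λ m₁ → m₁ ∈ blk y m × j ∈ merged-lab i m₁
      to j∈y with Equivalence.to (proj₂ x≤y i m j) j∈y
      ... | m₁ , m₁∈m , j∈x = m₁ , m₁∈m , lab⊆merged-lab i m₁ j∈x
      via-x : ∀ {m₁} → m₁ ∈ blk y m → j ∈ lab x i m₁ → j ∈ lab y i m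
      via-x m₁∈m j∈x = Equivalence.from (proj₂ x≤y i m j) (_ , m₁∈m , j∈x)
      from : (∃ λ m₁ → m₁ ∈ blk y m × j ∈ merged-lab i m₁) → j ∈ lab y i m
      from (m₁ , m₁∈m , j∈) with m₁ ∈? U
      ... | no _ = via-x m₁∈m j∈
      ... | yes m₁∈U with x∈p∪q⁻ (lab x i k) (lab x i k′) j∈
      ...   | inj₁ j∈k  = via-x (subst (k ∈_) (U-part m₁∈U m₁∈m) (blk-self y k)) j∈k
      ...   | inj₂ j∈k′ = via-x (subst (k′ ∈_) (U-part m₁∈U m₁∈m) k′∈y) j∈k′

  merged≉x : ¬ (merged ≈VP x)
  merged≉x (same-blk , _) = k′∉k (blk-sym x k∈k′)
    where
    k∈k′ : k ∈ blk x k′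
    k∈k′ = subst (k ∈_) (trans (sym (merged-blk-U k′∈U)) (same-blk k′)) k∈U

  covered⇒merged≈ : ∀ y → ⟨ x ⟩ ⋖ ⟨ y ⟩ → k′ ∈ blk y k → merged ≈VP y
  covered⇒merged≈ y ((x≤y , _) , covers) k′∈y with covers ⟨ merged ⟩ x≤merged (merged≤ y x≤y k′∈y)
  ... | inj₁ merged≈x = ⊥-elim (merged≉x merged≈x)
  ... | inj₂ merged≈y = merged≈y

module _ {n s : ℕ} where

  firstDifference⇒wA∉lab : ∀ {x y : VP n s} {k i} → x ≤VP y → FirstDifference x y k i →
                           ¬ (wA y i k ∈ lab x i k)
  firstDifference⇒wA∉lab {x} {y} {k} {i} x≤y fd@(_ , before) wy∈x =
    let k″ , _ , k″<k , wx≡wy = lab<wA⇒earlier x i k wy∈x (firstDifference⇒wA< {x = x} {y} x≤y fd)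
    in ℕ.<-irrefl (cong toℕ (wA-injective y i (trans (sym (before k″ i (inj₁ k″<k))) wx≡wy))) k″<k

  covering-merges : ∀ {x y : VP n s} {k i j} → ⟨ x ⟩ ⋖ ⟨ y ⟩ → labelVP x y ≡ label k i j →
                    ∃ λ k′ → j ∈ lab x i k′ × MergedFrom x y k k′
  covering-merges {x} {y} {k} {i} {j} x⋖y@((x≤y , _) , _) labelVP≡
    with labelVP≡label⇒firstDifference {x = x} {y} labelVP≡
  ... | fd , refl with Equivalence.to (proj₂ x≤y i k (wA y i k)) (wA∈lab y i k)
  ...   | k′ , k′∈y , j∈k′ with k′ ∈? blk x k
  ...     | yes k′∈x =
    ⊥-elim (firstDifference⇒wA∉lab {x = x} {y} x≤y fd (subst (_ ∈_) (lab-blk x i k k′ k′∈x) j∈k′))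
  ...     | no k′∉x = k′ , j∈k′ , λ m → sym (proj₁ (Merge.covered⇒merged≈ x k k′ k′∉x y x⋖y k′∈y) m)

lemma3p4 : (n s : ℕ) → 1 ≤ n → 1 ≤ s →
    -- (1)
    (∀ (x y : VP n s) → ⟨ x ⟩ ≤ ⟨ y ⟩ ₚ → LexLe (Aword y) (Aword x))
    -- (2)
    × (∀ (cs : List (VP n s)) → Saturated (0̂ ∷ map ⟨_⟩ cs) → HasAChange cs
         → ¬ Increasing (0̂ ∷ map ⟨_⟩ cs))
    -- (3)
    × (∀ (x y : VP n s) → ⟨ x ⟩ ⋖ ⟨ y ⟩ → ¬ (Aword x ≡ Aword y)
         → ∀ (k : Fin n) (i : Fin s) (j : Fin n)
         → λ′ ⟨ x ⟩ ⟨ y ⟩ ≡ (suc (toℕ k) , suc (toℕ i) , suc (toℕ j))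
         → (wA y i k ≡ j) × (toℕ (wA y i k) < toℕ (wA x i k)))
    -- (4)
    × (∀ (x y : VP n s) → ⟨ x ⟩ ⋖ ⟨ y ⟩ → ¬ (Aword x ≡ Aword y)
         → ∀ (k : Fin n) (i : Fin s) (j : Fin n)
         → λ′ ⟨ x ⟩ ⟨ y ⟩ ≡ (suc (toℕ k) , suc (toℕ i) , suc (toℕ j))
         → ∃ λ k′ → (j ∈ lab x i k′) × MergedFrom x y k k′)
    -- (5)
    × (∀ (x y : VP n s) → ⟨ x ⟩ ≤ ⟨ y ⟩ ₚ → ¬ (Aword x ≡ Aword y)
         → ∀ (k : Fin n) (i : Fin s) (j : Fin n)
         → ¬ (wA x i k ≡ wA y i k)
         → (∀ (k′ : Fin n) (i′ : Fin s)
              → (toℕ k′ < toℕ k) ⊎ ((k′ ≡ k) × (toℕ i′ < toℕ i))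
              → wA x i′ k′ ≡ wA y i′ k′)
         → wA y i k ≡ j
         → (∀ (cs : List (Π n s)) → MaxChain ⟨ x ⟩ ⟨ y ⟩ cs
              → countLabel (suc (toℕ k) , suc (toℕ i) , suc (toℕ j)) cs ≡ 1)
           × (∀ (u v : Π n s) → ⟨ x ⟩ ≤ u ₚ → v ≤ ⟨ y ⟩ ₚ → u ⋖ v
              → (suc (toℕ k) , suc (toℕ i) , suc (toℕ j)) ≤L λ′ u v))
lemma3p4 n s _ _ =
  (λ x y → A-antitone {x = x} {y})
  , (λ cs _ → bottom-chain-not-increasing cs)
  , (λ x y ((x≤y , _) , _) _ k i j → label-entry-decreases {x = x} {y} x≤y)
  , (λ x y x⋖y _ k i j → covering-merges {x = x} {y} x⋖y)
  , λ { x y x≤y _ k i _ differ before refl →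
        let open FirstDifferenceInterval x y x≤y k i differ before
        in maxChain⇒countLabel≡1 , λ₀≤λ′ }
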